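{- Let $\mathcal{H}$ be a hypergraph, $S,B \subseteq V(\mathcal{H})$ and $x \in S$. Let $\mathcal{H}_1 := \mathcal{H} \setminus \mathcal{H}(x)$ and $\mathcal{H}_2 := \mathcal{H} \setminus (\mathcal{H}(B) \cap \mathcal{H}(x))$. Then \[ \#\mathsf{btr}_{B}(\mathcal{H},S) = \#\mathsf{btr}_{B}(\mathcal{H},S\setminus\{x\}) + \#\mathsf{btr}_{B}(\mathcal{H}_1,S\setminus\{x\}) - \#\mathsf{btr}_{B \cup \{x\}}(\mathcal{H}_2,S\setminus\{x\}), \] where $\#$ denotes cardinality.
   Context: A hypergraph $\mathcal{H}$ is a finite collection of subsets (hyperedges) of a finite ground set; $V(\mathcal{H})=\bigcup_{e\in\mathcal{H}} e$. Any subset of $\mathcal{H}$ is a sub-hypergraph. For $S\subseteq V(\mathcal{H})$, $\mathcal{H}(S)=\{e\in\mathcal{H}\mid e\cap S\neq\emptyset\}$ and $\mathcal{H}(x)=\mathcal{H}(\{x\})$. A transversal of $\mathcal{H}$ is a set $T\subseteq V(\mathcal{H})$ meeting every hyperedge; $\mathsf{tr}(\mathcal{H})$ is the set of transversals and $\mathsf{mtr}(\mathcal{H})$ the set of inclusion-wise minimal ones ($\mathsf{mtr}(\emptyset)=\{\emptyset\}$). For a sub-hypergraph $\mathcal{H}'\subseteq\mathcal{H}$ and $B\subseteq V(\mathcal{H})$, $\mathsf{btr}_B(\mathcal{H}')=\mathsf{tr}(\mathcal{H}')\cap\mathsf{mtr}(\mathcal{H}'\setminus\mathcal{H}'(B))$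 (the $B$-blocked transversals: transversals $T$ of $\mathcal{H}'$ in which every $x\in T$ has some $e\in\mathcal{H}'\setminus\mathcal{H}'(B)$ with $e\cap T=\{x\}$). For $S\subseteq V(\mathcal{H})$, $\mathsf{btr}_B(\mathcal{H}',S)=\{T\in\mathsf{btr}_B(\mathcal{H}')\mid T\subseteq S\}$. -}

module Defs where

open import Data.Nat using (ℕ; zero; suc)
open import Data.Fin using (Fin)
open import Data.Fin.Subset using (Subset; _∩_; _∪_; _⊆_; _⊂_; Nonempty; ⊥; inside; outside)
open import Data.Fin.Subset.Properties using (nonempty?; _⊆?_; _⊂?_; anySubset?)
open import Data.List using (List; []; _∷_; _++_; map; filter; length; foldr)
open import Data.List.Relation.Unary.All using (All; all?)
open import Data.Product using (_×_; ∃; _,_)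
open import Data.Vec using (_∷_; [])
open import Relation.Nullary using (¬_; Dec)
open import Relation.Nullary.Decidable using (_×-dec_; ¬?)
open import Relation.Unary using (Decidable)

Hypergraph : ℕ → Set
Hypergraph n = List (Subset n)

private variable n : ℕ

V : Hypergraph n → Subset n
V = foldr _∪_ ⊥

Meets : Subset n → Subset n → Set
Meets S e = Nonempty (e ∩ S)

meets? : (S : Subset n) → Decidable (Meets S)
meets? S e = nonempty? (e ∩ S)

HS : Hypergraph n → Subset n → Hypergraph n
HS H S = filter (meets? S) H

HminusHS : Hypergraph n → Subset n → Hypergraph n
HminusHS H S = filter (λ e → ¬? (meets? S e)) H

HminusHBHX : Hypergraph n → Subset n → Subset n → Hypergraph n
HminusHBHX H B X = filter (λ e → ¬? (meets? B e ×-dec meets? X e)) H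

Transversal : Hypergraph n → Subset n → Set
Transversal H T = T ⊆ V H × All (Meets T) H

transversal? : (H : Hypergraph n) → Decidable (Transversal H)
transversal? H T = (T ⊆? V H) ×-dec all? (meets? T) H

MinTransversal : Hypergraph n → Subset n → Set
MinTransversal H T = Transversal H T × ¬ ∃ (λ T′ → T′ ⊂ T × Transversal H T′)

minTransversal? : (H : Hypergraph n) → Decidable (MinTransversal H)
minTransversal? H T =
  transversal? H T ×-dec ¬? (anySubset? (λ T′ → (T′ ⊂? T) ×-dec transversal? H T′))

BlockedTransversal : Subset n → Hypergraph n → Subset n → Set
BlockedTransversal B H T = Transversal H T × MinTransversal (HminusHS H B) T

blockedTransversal? : (B : Subset n) (H : Hypergraph n) → Decidable (BlockedTransversal B H)
blockedTransversal? B H T = transversal? H T ×-dec minTransversal? (HminusHS H B) T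

BlockedTransversalIn : Subset n → Hypergraph n → Subset n → Subset n → Set
BlockedTransversalIn B H S T = BlockedTransversal B H T × T ⊆ S

blockedTransversalIn? : (B : Subset n) (H : Hypergraph n) (S : Subset n) →
                        Decidable (BlockedTransversalIn B H S)
blockedTransversalIn? B H S T = blockedTransversal? B H T ×-dec (T ⊆? S)

allSubsets : (n : ℕ) → List (Subset n)
allSubsets zero = [] ∷ []
allSubsets (suc n) = map (inside ∷_) (allSubsets n) ++ map (outside ∷_) (allSubsets n)

count : {P : Subset n → Set} → Decidable P → ℕ
count {n = n} P? = length (filter P? (allSubsets n))

#btr : Subset n → Hypergraph n → Subset n → ℕ
#btr B H S = count (blockedTransversalIn? B H S)

-- Split btr_B(H, S) by whether x ∈ T; those avoiding x form btr_B(H, S ∖ {x}). A blocked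
-- transversal is a transversal in which every y ∈ T has a private edge (one meeting T only in y)
-- avoiding B. Then T ↦ T ∪ {x} maps the T ∈ btr_B(H₁, S ∖ {x}) that are not transversals of H₂
-- bijectively onto the part containing x: the private edge of x avoids T and B, so lies in H₂,
-- and the other private edges avoid x. The T that are transversals of H₂ are exactly
-- btr_{B∪{x}}(H₂, S ∖ {x}), since H₁ ⊆ H₂ and both have the same edges avoiding B ∪ {x}.
module Submission where

open import Defs
open import Data.Nat using (ℕ)
open import Data.Fin using (Fin)
open import Data.Fin.Subset using (Subset; _⊆_; _∈_; _∪_; ⁅_⁆; _─_)
open import Data.Integer using (+_; _+_; _-_)
open import Relation.Binary.PropositionalEquality using (_≡_)

open import Level using (Level)
open import Data.Integer.Properties using (+-0-abelianGroup)
open import Algebra.Properties.AbelianGroup +-0-abelianGroup using (xyx⁻¹≈y)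
import Data.Nat as ℕ
import Data.Nat.Properties as ℕ
open import Data.Bool.Properties using (∨-identityʳ)
open import Data.Empty using (⊥-elim)
open import Data.Fin as Fin using (zero; suc)
open import Data.Fin.Subset using (_∉_; _⊂_; inside; outside)
open import Data.Fin.Subset.Properties
  using ( _∈?_; x∈p∩q⁺; x∈p∩q⁻; x∈p∪q⁺; x∈p∪q⁻; x∈⁅x⁆; x∈⁅y⁆⇒x≡y; x∈p∧x∉q⇒x∈p─q; x∈p∧x≢y⇒x∈p-y
        ; p─q⊆p; p⊆p∪q; q⊆p∪q; x∈p⇒p-x⊂p; drop-there; ∪-identityʳ)
open import Data.List using (List; []; _∷_; _++_; filter; length)
import Data.List as List
open import Data.List.Membership.Propositional using (find) renaming (_∈_ to _∈ₗ_)
open import Data.List.Membership.Propositional.Properties using (∈-filter⁺; ∈-filter⁻)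
open import Data.List.Properties using (filter-++; length-++; filter-≐; filter-none)
open import Data.List.Relation.Binary.Subset.Propositional using () renaming (_⊆_ to _⊆ₗ_)
open import Data.List.Relation.Binary.Subset.Propositional.Properties using (filter-⊆)
open import Data.List.Relation.Unary.All as All using (All; all?)
open import Data.List.Relation.Unary.Any using (here; there)
open import Data.List.Relation.Unary.All.Properties using (¬All⇒Any¬; anti-mono)
open import Data.Vec using (_∷_; here; there)
open import Data.Product using (_×_; ∃; _,_; proj₁; proj₂; map; map₂; assocʳ′; assocˡ′)
open import Data.Sum as Sum using (_⊎_; inj₁; inj₂)
open import Function using (_∘_; id)
open import Function.Bundles using (_⇔_; mk⇔; Equivalence)
open import Function.Construct.Composition using (_⇔-∘_)
open import Function.Construct.Identity using (⇔-id)
open import Function.Construct.Symmetry using (⇔-sym)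
open import Data.Product.Function.NonDependent.Propositional using (_×-⇔_)
open import Relation.Binary.PropositionalEquality using (refl; sym; trans; cong; cong₂; subst; module ≡-Reasoning)
open import Relation.Nullary using (¬_; yes; no)
open import Relation.Nullary.Decidable using (_×-dec_; ¬?; decidable-stable)
open import Relation.Unary using (Pred; Decidable)
open import Relation.Unary.Properties using (_∩?_; ∁?)

private variable
  ℓ ℓ₁ ℓ₂ : Level
  A A′ : Set ℓ
  n : ℕ
  x y z : Fin n
  B S T e : Subset n
  G G′ : Hypergraph n

module _ {P : Pred A ℓ₁} (P? : Decidable P) where

  length-filter-map : (f : A′ → A) (xs : List A′) →
                      length (filter P? (List.map f xs)) ≡ length (filter (λ y → P? (f y)) xs)
  length-filter-map f [] = refl
  length-filter-map f (y ∷ xs) with P? (f y)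
  ... | yes _ = cong ℕ.suc (length-filter-map f xs)
  ... | no  _ = length-filter-map f xs

  length-filter-split : {R : Pred A ℓ₂} (R? : Decidable R) (xs : List A) →
                        length (filter P? xs) ≡
                        length (filter (P? ∩? R?) xs) ℕ.+ length (filter (P? ∩? ∁? R?) xs)
  length-filter-split R? [] = refl
  length-filter-split R? (y ∷ xs) with P? y | R? y
  ... | yes _ | yes _ = cong ℕ.suc (length-filter-split R? xs)
  ... | yes _ | no  _ = trans (cong ℕ.suc (length-filter-split R? xs)) (sym (ℕ.+-suc _ _))
  ... | no  _ | yes _ = length-filter-split R? xs
  ... | no  _ | no  _ = length-filter-split R? xs

module _ {P : Subset n → Set} (P? : Decidable P) where

  count-cong : {Q : Subset n → Set} (Q? : Decidable Q) → (∀ {T} → P T ⇔ Q T) → count P? ≡ count Q?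
  count-cong Q? P⇔Q = cong length (filter-≐ P? Q? (Equivalence.to P⇔Q , Equivalence.from P⇔Q) (allSubsets n))

  count-none : (∀ T → ¬ P T) → count P? ≡ 0
  count-none ¬P = cong length (filter-none P? {allSubsets n} (All.tabulate (λ {T} _ → ¬P T)))

  count-split : {R : Subset n → Set} (R? : Decidable R) → count P? ≡ count (P? ∩? R?) ℕ.+ count (P? ∩? ∁? R?)
  count-split R? = length-filter-split P? R? (allSubsets n)

count-suc : {P : Subset (ℕ.suc n) → Set} (P? : Decidable P) →
            count P? ≡ count (λ T → P? (inside ∷ T)) ℕ.+ count (λ T → P? (outside ∷ T))
count-suc {n} P? = begin
  length (filter P? (List.map (inside ∷_) Ts ++ List.map (outside ∷_) Ts))
    ≡⟨ cong length (filter-++ P? (List.map (inside ∷_) Ts) _) ⟩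
  length (filter P? (List.map (inside ∷_) Ts) ++ filter P? (List.map (outside ∷_) Ts))
    ≡⟨ length-++ (filter P? (List.map (inside ∷_) Ts)) ⟩
  length (filter P? (List.map (inside ∷_) Ts)) ℕ.+ length (filter P? (List.map (outside ∷_) Ts))
    ≡⟨ cong₂ ℕ._+_ (length-filter-map P? _ Ts) (length-filter-map P? _ Ts) ⟩
  count (λ T → P? (inside ∷ T)) ℕ.+ count (λ T → P? (outside ∷ T)) ∎
  where
  open ≡-Reasoning
  Ts = allSubsets n

∷-∪-⁅zero⁆ : (T : Subset n) → (outside ∷ T) ∪ ⁅ zero ⁆ ≡ inside ∷ T
∷-∪-⁅zero⁆ T = cong (inside ∷_) (∪-identityʳ T)

∷-∪-⁅suc⁆ : ∀ b (T : Subset n) (x : Fin n) → (b ∷ T) ∪ ⁅ suc x ⁆ ≡ b ∷ (T ∪ ⁅ x ⁆)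
∷-∪-⁅suc⁆ b T x = cong (_∷ (T ∪ ⁅ x ⁆)) (∨-identityʳ b)

-- T ↦ T ∪ {x} is a bijection from the subsets avoiding x onto those containing x.
count-∈≡count-∉-∪⁅⁆ : {P : Subset n → Set} (P? : Decidable P) (x : Fin n) →
                      count (λ T → P? T ×-dec x ∈? T) ≡ count (λ T → P? (T ∪ ⁅ x ⁆) ×-dec ¬? (x ∈? T))
count-∈≡count-∉-∪⁅⁆ {ℕ.suc n} {P} P? zero = begin
    count with-0
  ≡⟨ count-suc with-0 ⟩
    count (λ T → with-0 (inside ∷ T)) ℕ.+ count (λ T → with-0 (outside ∷ T))
  ≡⟨ cong₂ ℕ._+_ (count-cong (λ T → with-0 (inside ∷ T)) P-inside (mk⇔ proj₁ (_, here)))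
                 (count-none (λ T → with-0 (outside ∷ T)) (λ _ ())) ⟩
    count P-inside ℕ.+ 0
  ≡⟨ ℕ.+-identityʳ _ ⟩
    count P-inside
  ≡⟨ cong₂ ℕ._+_ (count-none (λ T → without-0 (inside ∷ T)) (λ _ p → proj₂ p here))
                 (count-cong (λ T → without-0 (outside ∷ T)) P-inside
                    (mk⇔ (subst P (∷-∪-⁅zero⁆ _) ∘ proj₁) (λ p → subst P (sym (∷-∪-⁅zero⁆ _)) p , λ ()))) ⟨
    count (λ T → without-0 (inside ∷ T)) ℕ.+ count (λ T → without-0 (outside ∷ T))
  ≡⟨ count-suc without-0 ⟨
    count without-0 ∎
  where
  open ≡-Reasoning
  with-0 : Decidable (λ T → P T × zero ∈ T)
  with-0 T = P? T ×-dec zero ∈? T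
  without-0 : Decidable (λ T → P (T ∪ ⁅ zero ⁆) × zero ∉ T)
  without-0 T = P? (T ∪ ⁅ zero ⁆) ×-dec ¬? (zero ∈? T)
  P-inside : Decidable (λ T → P (inside ∷ T))
  P-inside T = P? (inside ∷ T)
count-∈≡count-∉-∪⁅⁆ {ℕ.suc n} {P} P? (suc x) = begin
    count with-x
  ≡⟨ count-suc with-x ⟩
    count (λ T → with-x (inside ∷ T)) ℕ.+ count (λ T → with-x (outside ∷ T))
  ≡⟨ cong₂ ℕ._+_ (shift inside) (shift outside) ⟩
    count (λ T → without-x (inside ∷ T)) ℕ.+ count (λ T → without-x (outside ∷ T))
  ≡⟨ count-suc without-x ⟨
    count without-x ∎
  where
  open ≡-Reasoning
  with-x : Decidable (λ T → P T × suc x ∈ T)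
  with-x T = P? T ×-dec suc x ∈? T
  without-x : Decidable (λ T → P (T ∪ ⁅ suc x ⁆) × suc x ∉ T)
  without-x T = P? (T ∪ ⁅ suc x ⁆) ×-dec ¬? (suc x ∈? T)
  shift : ∀ b → count (λ T → with-x (b ∷ T)) ≡ count (λ T → without-x (b ∷ T))
  shift b = begin
      count (λ T → with-x (b ∷ T))
    ≡⟨ count-cong (λ T → with-x (b ∷ T)) (λ T → P? (b ∷ T) ×-dec x ∈? T)
                  (mk⇔ (map₂ drop-there) (map₂ there)) ⟩
      count (λ T → P? (b ∷ T) ×-dec x ∈? T)
    ≡⟨ count-∈≡count-∉-∪⁅⁆ (λ T → P? (b ∷ T)) x ⟩
      count (λ T → P? (b ∷ (T ∪ ⁅ x ⁆)) ×-dec ¬? (x ∈? T))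
    ≡⟨ count-cong (λ T → P? (b ∷ (T ∪ ⁅ x ⁆)) ×-dec ¬? (x ∈? T)) (λ T → without-x (b ∷ T))
                  (mk⇔ (map (subst P (sym (∷-∪-⁅suc⁆ b _ x))) (_∘ drop-there))
                       (map (subst P (∷-∪-⁅suc⁆ b _ x)) (_∘ there))) ⟩
      count (λ T → without-x (b ∷ T)) ∎

x∈p─q⇒x∉q : ∀ (p q : Subset n) → x ∈ p ─ q → x ∉ q
x∈p─q⇒x∉q (s ∷ p) (outside ∷ q) here        ()
x∈p─q⇒x∉q (s ∷ p) (outside ∷ q) (there x∈p─q) (there x∈q) = x∈p─q⇒x∉q p q x∈p─q x∈q
x∈p─q⇒x∉q (s ∷ p) (inside  ∷ q) (there x∈p─q) (there x∈q) = x∈p─q⇒x∉q p q x∈p─q x∈q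

⊆─⁅⁆⇔ : (T ⊆ S × x ∉ T) ⇔ T ⊆ S ─ ⁅ x ⁆
⊆─⁅⁆⇔ {T = T} {S = S} {x = x} = mk⇔
  (λ (T⊆S , x∉T) {z} z∈T → x∈p∧x∉q⇒x∈p─q (T⊆S z∈T)
                                 (λ z∈⁅x⁆ → x∉T (subst (_∈ T) (x∈⁅y⁆⇒x≡y x z∈⁅x⁆) z∈T)))
  (λ T⊆S─x → (λ {z} z∈T → p─q⊆p S ⁅ x ⁆ (T⊆S─x z∈T)) ,
             (λ x∈T → x∈p─q⇒x∉q S ⁅ x ⁆ (T⊆S─x x∈T) (x∈⁅x⁆ x)))

∈-∪⁅⁆⁻ : z ∈ T ∪ ⁅ x ⁆ → z ∈ T ⊎ z ≡ x
∈-∪⁅⁆⁻ {T = T} {x = x} z∈T∪x = Sum.map₂ (x∈⁅y⁆⇒x≡y x) (x∈p∪q⁻ T ⁅ x ⁆ z∈T∪x)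

x∈p∪⁅x⁆ : x ∈ T ∪ ⁅ x ⁆
x∈p∪⁅x⁆ {x = x} = x∈p∪q⁺ (inj₂ (x∈⁅x⁆ x))

Meets⁺ : z ∈ e → z ∈ S → Meets S e
Meets⁺ z∈e z∈S = _ , x∈p∩q⁺ (z∈e , z∈S)

Meets⁻ : Meets S e → ∃ λ z → z ∈ e × z ∈ S
Meets⁻ {S = S} {e = e} (z , z∈e∩S) = z , x∈p∩q⁻ e S z∈e∩S

Meets-mono : S ⊆ T → Meets S e → Meets T e
Meets-mono S⊆T S∩e = let _ , z∈e , z∈S = Meets⁻ S∩e in Meets⁺ z∈e (S⊆T z∈S)

Meets-∪⁻ : Meets (B ∪ S) e → Meets B e ⊎ Meets S e
Meets-∪⁻ {B = B} {S = S} B∪S∩e =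
  let _ , z∈e , z∈B∪S = Meets⁻ B∪S∩e in Sum.map (Meets⁺ z∈e) (Meets⁺ z∈e) (x∈p∪q⁻ B S z∈B∪S)

Meets-⁅⁆⁺ : x ∈ e → Meets ⁅ x ⁆ e
Meets-⁅⁆⁺ {x = x} x∈e = Meets⁺ x∈e (x∈⁅x⁆ x)

Meets-⁅⁆⁻ : Meets ⁅ x ⁆ e → x ∈ e
Meets-⁅⁆⁻ {x = x} {e = e} x∩e =
  let _ , z∈e , z∈⁅x⁆ = Meets⁻ x∩e in subst (_∈ e) (x∈⁅y⁆⇒x≡y x z∈⁅x⁆) z∈e

∈⇒⊆V : e ∈ₗ G → e ⊆ V G
∈⇒⊆V (here refl)  y∈e = x∈p∪q⁺ (inj₁ y∈e)
∈⇒⊆V (there e∈G) y∈e = x∈p∪q⁺ (inj₂ (∈⇒⊆V e∈G y∈e))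

∈-HminusHS⁺ : ∀ G B → e ∈ₗ G → ¬ Meets B e → e ∈ₗ HminusHS G B
∈-HminusHS⁺ G B = ∈-filter⁺ (λ e → ¬? (meets? B e)) {xs = G}

∈-HminusHS⁻ : ∀ G B → e ∈ₗ HminusHS G B → e ∈ₗ G × ¬ Meets B e
∈-HminusHS⁻ G B = ∈-filter⁻ (λ e → ¬? (meets? B e)) {xs = G}

∈-HminusHBHX⁺ : ∀ G B S → e ∈ₗ G → ¬ (Meets B e × Meets S e) → e ∈ₗ HminusHBHX G B S
∈-HminusHBHX⁺ G B S = ∈-filter⁺ (λ e → ¬? (meets? B e ×-dec meets? S e)) {xs = G}

∈-HminusHBHX⁻ : ∀ G B S → e ∈ₗ HminusHBHX G B S → e ∈ₗ G × ¬ (Meets B e × Meets S e)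
∈-HminusHBHX⁻ G B S = ∈-filter⁻ (λ e → ¬? (meets? B e ×-dec meets? S e)) {xs = G}

PrivateEdge : Hypergraph n → Subset n → Fin n → Set
PrivateEdge G T y = ∃ λ e → e ∈ₗ G × y ∈ e × (∀ {z} → z ∈ e → z ∈ T → z ≡ y)

PrivateEdge-mono : G ⊆ₗ G′ → PrivateEdge G T y → PrivateEdge G′ T y
PrivateEdge-mono G⊆G′ (e , e∈G , private-y) = e , G⊆G′ e∈G , private-y

privateEdges⇒⊆V : (∀ {y} → y ∈ T → PrivateEdge G T y) → T ⊆ V G
privateEdges⇒⊆V privateEdge y∈T = let e , e∈G , y∈e , _ = privateEdge y∈T in ∈⇒⊆V e∈G y∈e

minTransversal⇒privateEdge : MinTransversal G T → y ∈ T → PrivateEdge G T y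
minTransversal⇒privateEdge {G = G} {T = T} {y = y} ((T⊆V , hits) , minimal) y∈T
  with all? (meets? (T ─ ⁅ y ⁆)) G
... | yes hits′ =
  ⊥-elim (minimal (T ─ ⁅ y ⁆ , x∈p⇒p-x⊂p y∈T , (λ z∈T─y → T⊆V (p─q⊆p T ⁅ y ⁆ z∈T─y)) , hits′))
... | no ¬hits′ with find (¬All⇒Any¬ (meets? (T ─ ⁅ y ⁆)) G ¬hits′)
... | e , e∈G , misses = e , e∈G , y∈e , only-y
  where
  only-y : ∀ {z} → z ∈ e → z ∈ T → z ≡ y
  only-y {z} z∈e z∈T = decidable-stable (z Fin.≟ y) (λ z≢y → misses (Meets⁺ z∈e (x∈p∧x≢y⇒x∈p-y z∈T z≢y)))
  y∈e : y ∈ e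
  y∈e = let z , z∈e , z∈T = Meets⁻ (All.lookup hits e∈G) in subst (_∈ e) (only-y z∈e z∈T) z∈e

privateEdges⇒minTransversal : All (Meets T) G → (∀ {y} → y ∈ T → PrivateEdge G T y) → MinTransversal G T
privateEdges⇒minTransversal {T = T} {G = G} hits privateEdge = (privateEdges⇒⊆V privateEdge , hits) , no-smaller
  where
  no-smaller : ¬ ∃ λ T′ → T′ ⊂ T × Transversal G T′
  no-smaller (T′ , (T′⊆T , y , y∈T , y∉T′) , _ , hits′) =
    let e , e∈G , _ , only-y = privateEdge y∈T
        z , z∈e , z∈T′ = Meets⁻ (All.lookup hits′ e∈G)
    in y∉T′ (subst (_∈ T′) (only-y z∈e (T′⊆T z∈T′)) z∈T′)

record IsBlocked (B : Subset n) (G : Hypergraph n) (S T : Subset n) : Set where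
  field
    hits        : All (Meets T) G
    privateEdge : ∀ {y} → y ∈ T → PrivateEdge (HminusHS G B) T y
    within      : T ⊆ S

blockedTransversalIn⇔isBlocked : BlockedTransversalIn B G S T ⇔ IsBlocked B G S T
blockedTransversalIn⇔isBlocked {B = B} {G = G} {S = S} {T = T} = mk⇔ to from
  where
  to : BlockedTransversalIn B G S T → IsBlocked B G S T
  to (((_ , hits) , minimal) , T⊆S) = record
    { hits = hits ; privateEdge = minTransversal⇒privateEdge minimal ; within = T⊆S }
  from : IsBlocked B G S T → BlockedTransversalIn B G S T
  from blocked = ((privateEdges⇒⊆V (λ y∈T → PrivateEdge-mono (filter-⊆ _ G) (privateEdge y∈T)) , hits) ,
                  privateEdges⇒minTransversal (anti-mono (filter-⊆ _ G) hits) privateEdge) , within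
    where open IsBlocked blocked

isBlocked-transfer : {B′ : Subset n} → G ⊆ₗ G′ →
                     HminusHS G B ⊆ₗ HminusHS G′ B′ → HminusHS G′ B′ ⊆ₗ HminusHS G B →
                     (IsBlocked B G S T × All (Meets T) G′) ⇔ IsBlocked B′ G′ S T
isBlocked-transfer G⊆G′ F⊆F′ F′⊆F = mk⇔
  (λ (blocked , hits′) → record
    { hits = hits′ ; privateEdge = λ y∈T → PrivateEdge-mono F⊆F′ (privateEdge blocked y∈T) ; within = within blocked })
  (λ blocked′ → record
    { hits = anti-mono G⊆G′ (hits blocked′) ; privateEdge = λ y∈T → PrivateEdge-mono F′⊆F (privateEdge blocked′ y∈T)
    ; within = within blocked′ } , hits blocked′)
  where open IsBlocked

blockedTransversalIn-─⁅⁆ : (BlockedTransversalIn B G S T × x ∉ T) ⇔ BlockedTransversalIn B G (S ─ ⁅ x ⁆) T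
blockedTransversalIn-─⁅⁆ = (⇔-id _ ×-⇔ ⊆─⁅⁆⇔) ⇔-∘ mk⇔ assocʳ′ assocˡ′

module _ (H : Hypergraph n) (B : Subset n) (x : Fin n) where

  private
    H₁ H₂ : Hypergraph n
    H₁ = HminusHS H ⁅ x ⁆
    H₂ = HminusHBHX H B ⁅ x ⁆

  H₁⊆H₂ : H₁ ⊆ₗ H₂
  H₁⊆H₂ e∈H₁ =
    let e∈H , ¬x∩e = ∈-HminusHS⁻ H ⁅ x ⁆ e∈H₁ in ∈-HminusHBHX⁺ H B ⁅ x ⁆ e∈H (¬x∩e ∘ proj₂)

  free-H₁⊆free-H₂ : HminusHS H₁ B ⊆ₗ HminusHS H₂ (B ∪ ⁅ x ⁆)
  free-H₁⊆free-H₂ e∈F₁ =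
    let e∈H₁ , ¬B∩e = ∈-HminusHS⁻ H₁ B e∈F₁
        _ , ¬x∩e = ∈-HminusHS⁻ H ⁅ x ⁆ e∈H₁
    in ∈-HminusHS⁺ H₂ (B ∪ ⁅ x ⁆) (H₁⊆H₂ e∈H₁) (Sum.[ ¬B∩e , ¬x∩e ]′ ∘ Meets-∪⁻)

  free-H₂⊆free-H₁ : HminusHS H₂ (B ∪ ⁅ x ⁆) ⊆ₗ HminusHS H₁ B
  free-H₂⊆free-H₁ e∈F₂ =
    let e∈H₂ , ¬B∪x∩e = ∈-HminusHS⁻ H₂ (B ∪ ⁅ x ⁆) e∈F₂
        e∈H , _ = ∈-HminusHBHX⁻ H B ⁅ x ⁆ e∈H₂
    in ∈-HminusHS⁺ H₁ B (∈-HminusHS⁺ H ⁅ x ⁆ e∈H (¬B∪x∩e ∘ Meets-mono (q⊆p∪q B ⁅ x ⁆)))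
                   (¬B∪x∩e ∘ Meets-mono (p⊆p∪q ⁅ x ⁆))

  isBlocked-H₂⇔ : (IsBlocked B H₁ S T × All (Meets T) H₂) ⇔ IsBlocked (B ∪ ⁅ x ⁆) H₂ S T
  isBlocked-H₂⇔ = isBlocked-transfer H₁⊆H₂ free-H₁⊆free-H₂ free-H₂⊆free-H₁

  privateEdge-∪⁅⁆ : PrivateEdge (HminusHS H₁ B) T y → PrivateEdge (HminusHS H B) (T ∪ ⁅ x ⁆) y
  privateEdge-∪⁅⁆ (e , e∈F₁ , y∈e , only-y) =
    let e∈H₁ , ¬B∩e = ∈-HminusHS⁻ H₁ B e∈F₁
        e∈H , ¬x∩e = ∈-HminusHS⁻ H ⁅ x ⁆ e∈H₁
    in e , ∈-HminusHS⁺ H B e∈H ¬B∩e , y∈e , λ z∈e z∈T∪x →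
         Sum.[ only-y z∈e , (λ z≡x → ⊥-elim (¬x∩e (Meets-⁅⁆⁺ (subst (_∈ e) z≡x z∈e)))) ]′
               (∈-∪⁅⁆⁻ z∈T∪x)

  privateEdge-∪⁅⁆⁻ : x ∉ T → y ∈ T → PrivateEdge (HminusHS H B) (T ∪ ⁅ x ⁆) y → PrivateEdge (HminusHS H₁ B) T y
  privateEdge-∪⁅⁆⁻ {T = T} x∉T y∈T (e , e∈F , y∈e , only-y) with ∈-HminusHS⁻ H B e∈F
  ... | e∈H , ¬B∩e =
    e , ∈-HminusHS⁺ H₁ B (∈-HminusHS⁺ H ⁅ x ⁆ e∈H ¬x∩e) ¬B∩e , y∈e ,
    λ z∈e z∈T → only-y z∈e (p⊆p∪q ⁅ x ⁆ z∈T)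
    where
    ¬x∩e : ¬ Meets ⁅ x ⁆ e
    ¬x∩e x∩e = x∉T (subst (_∈ T) (sym (only-y (Meets-⁅⁆⁻ x∩e) x∈p∪⁅x⁆)) y∈T)

  -- The private edge of x is an edge of H₂ missed by T: it contains x since T meets all of H₁,
  -- so it avoids B.
  privateEdge-x : All (Meets T) H₁ → ¬ All (Meets T) H₂ → PrivateEdge (HminusHS H B) (T ∪ ⁅ x ⁆) x
  privateEdge-x {T = T} hits₁ ¬hits₂ with find (¬All⇒Any¬ (meets? T) H₂ ¬hits₂)
  ... | e , e∈H₂ , ¬T∩e with ∈-HminusHBHX⁻ H B ⁅ x ⁆ e∈H₂
  ... | e∈H , ¬[B∩e×x∩e] =
    e , ∈-HminusHS⁺ H B e∈H (λ B∩e → ¬[B∩e×x∩e] (B∩e , Meets-⁅⁆⁺ x∈e)) , x∈e , λ z∈e z∈T∪x →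
      Sum.[ (λ z∈T → ⊥-elim (¬T∩e (Meets⁺ z∈e z∈T))) , id ]′ (∈-∪⁅⁆⁻ z∈T∪x)
    where
    x∈e : x ∈ e
    x∈e = decidable-stable (x ∈? e) λ x∉e →
      ¬T∩e (All.lookup hits₁ (∈-HminusHS⁺ H ⁅ x ⁆ e∈H (x∉e ∘ Meets-⁅⁆⁻)))

  privateEdge-x⇒¬hits : x ∉ T → PrivateEdge (HminusHS H B) (T ∪ ⁅ x ⁆) x → ¬ All (Meets T) H₂
  privateEdge-x⇒¬hits {T = T} x∉T (e , e∈F , x∈e , only-x) hits₂ =
    let e∈H , ¬B∩e = ∈-HminusHS⁻ H B e∈F
        z , z∈e , z∈T = Meets⁻ (All.lookup hits₂ (∈-HminusHBHX⁺ H B ⁅ x ⁆ e∈H (¬B∩e ∘ proj₁)))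
    in x∉T (subst (_∈ T) (only-x z∈e (p⊆p∪q ⁅ x ⁆ z∈T)) z∈T)

  isBlocked-∪⁅⁆⇔ : x ∈ S →
                   (IsBlocked B H₁ (S ─ ⁅ x ⁆) T × ¬ All (Meets T) H₂) ⇔ (IsBlocked B H S (T ∪ ⁅ x ⁆) × x ∉ T)
  isBlocked-∪⁅⁆⇔ {S = S} {T = T} x∈S = mk⇔ extend restrict
    where
    extend : IsBlocked B H₁ (S ─ ⁅ x ⁆) T × ¬ All (Meets T) H₂ → IsBlocked B H S (T ∪ ⁅ x ⁆) × x ∉ T
    extend (blocked , ¬hits₂) = record
      { hits = All.tabulate hits′ ; privateEdge = privateEdge′ ; within = within′ } , x∉T
      where
      open IsBlocked blocked
      T⊆S = proj₁ (Equivalence.from ⊆─⁅⁆⇔ within)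
      x∉T = proj₂ (Equivalence.from ⊆─⁅⁆⇔ within)
      hits′ : e ∈ₗ H → Meets (T ∪ ⁅ x ⁆) e
      hits′ {e} e∈H with meets? ⁅ x ⁆ e
      ... | yes x∩e = Meets-mono (q⊆p∪q T ⁅ x ⁆) x∩e
      ... | no ¬x∩e = Meets-mono (p⊆p∪q ⁅ x ⁆) (All.lookup hits (∈-HminusHS⁺ H ⁅ x ⁆ e∈H ¬x∩e))
      privateEdge′ : y ∈ T ∪ ⁅ x ⁆ → PrivateEdge (HminusHS H B) (T ∪ ⁅ x ⁆) y
      privateEdge′ y∈T∪x with ∈-∪⁅⁆⁻ y∈T∪x
      ... | inj₁ y∈T  = privateEdge-∪⁅⁆ (privateEdge y∈T)
      ... | inj₂ refl = privateEdge-x hits ¬hits₂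
      within′ : T ∪ ⁅ x ⁆ ⊆ S
      within′ z∈T∪x with ∈-∪⁅⁆⁻ z∈T∪x
      ... | inj₁ z∈T  = T⊆S z∈T
      ... | inj₂ refl = x∈S
    restrict : IsBlocked B H S (T ∪ ⁅ x ⁆) × x ∉ T → IsBlocked B H₁ (S ─ ⁅ x ⁆) T × ¬ All (Meets T) H₂
    restrict (blocked , x∉T) = record
      { hits = All.tabulate hits₁
      ; privateEdge = λ y∈T → privateEdge-∪⁅⁆⁻ x∉T y∈T (privateEdge (p⊆p∪q ⁅ x ⁆ y∈T))
      ; within = Equivalence.to ⊆─⁅⁆⇔ ((λ z∈T → within (p⊆p∪q ⁅ x ⁆ z∈T)) , x∉T)
      } , privateEdge-x⇒¬hits x∉T (privateEdge x∈p∪⁅x⁆)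
      where
      open IsBlocked blocked
      hits₁ : e ∈ₗ H₁ → Meets T e
      hits₁ e∈H₁ = let e∈H , ¬x∩e = ∈-HminusHS⁻ H ⁅ x ⁆ e∈H₁ in
        Sum.[ id , ⊥-elim ∘ ¬x∩e ]′ (Meets-∪⁻ (All.lookup hits e∈H))

  count-btr-H₁-hitting-H₂ : (S : Subset n) →
    count (λ T → blockedTransversalIn? B H₁ S T ×-dec all? (meets? T) H₂) ≡ #btr (B ∪ ⁅ x ⁆) H₂ S
  count-btr-H₁-hitting-H₂ S =
    count-cong (λ T → blockedTransversalIn? B H₁ S T ×-dec all? (meets? T) H₂) (blockedTransversalIn? (B ∪ ⁅ x ⁆) H₂ S)
      (⇔-sym blockedTransversalIn⇔isBlocked ⇔-∘ (isBlocked-H₂⇔ ⇔-∘ (blockedTransversalIn⇔isBlocked ×-⇔ ⇔-id _)))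

  count-btr-H₁-missing-H₂ : (S : Subset n) → x ∈ S →
    count (λ T → blockedTransversalIn? B H₁ (S ─ ⁅ x ⁆) T ×-dec ¬? (all? (meets? T) H₂)) ≡
    count (λ T → blockedTransversalIn? B H S (T ∪ ⁅ x ⁆) ×-dec ¬? (x ∈? T))
  count-btr-H₁-missing-H₂ S x∈S =
    count-cong (λ T → blockedTransversalIn? B H₁ (S ─ ⁅ x ⁆) T ×-dec ¬? (all? (meets? T) H₂))
               (λ T → blockedTransversalIn? B H S (T ∪ ⁅ x ⁆) ×-dec ¬? (x ∈? T))
      ((⇔-sym blockedTransversalIn⇔isBlocked ×-⇔ ⇔-id _) ⇔-∘
       (isBlocked-∪⁅⁆⇔ x∈S ⇔-∘ (blockedTransversalIn⇔isBlocked ×-⇔ ⇔-id _)))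

theorem1 : {n : ℕ} (H : Hypergraph n) (S B : Subset n) (x : Fin n) →
           S ⊆ V H → B ⊆ V H → x ∈ S →
           + #btr B H S ≡
             (+ #btr B H (S ─ ⁅ x ⁆) + + #btr B (HminusHS H ⁅ x ⁆) (S ─ ⁅ x ⁆))
             - + #btr (B ∪ ⁅ x ⁆) (HminusHBHX H B ⁅ x ⁆) (S ─ ⁅ x ⁆)
theorem1 H S B x _ _ x∈S = begin
    + #btr B H S                  ≡⟨ cong +_ btr≡K+a ⟩
    + (K ℕ.+ a)                   ≡⟨ xyx⁻¹≈y (+ c) (+ (K ℕ.+ a)) ⟨
    + (c ℕ.+ (K ℕ.+ a)) - + c     ≡⟨ cong (λ m → + m - + c) c+[K+a]≡a+b ⟩
    + (a ℕ.+ b) - + c             ∎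
  where
  open ≡-Reasoning
  a = #btr B H (S ─ ⁅ x ⁆)
  b = #btr B (HminusHS H ⁅ x ⁆) (S ─ ⁅ x ⁆)
  c = #btr (B ∪ ⁅ x ⁆) (HminusHBHX H B ⁅ x ⁆) (S ─ ⁅ x ⁆)
  K = count (λ T → blockedTransversalIn? B H S (T ∪ ⁅ x ⁆) ×-dec ¬? (x ∈? T))
  btr≡K+a : #btr B H S ≡ K ℕ.+ a
  btr≡K+a = trans (count-split (blockedTransversalIn? B H S) (x ∈?_))
                  (cong₂ ℕ._+_ (count-∈≡count-∉-∪⁅⁆ (blockedTransversalIn? B H S) x)
                               (count-cong _ (blockedTransversalIn? B H (S ─ ⁅ x ⁆)) blockedTransversalIn-─⁅⁆))
  b≡c+K : b ≡ c ℕ.+ K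
  b≡c+K = trans (count-split (blockedTransversalIn? B (HminusHS H ⁅ x ⁆) (S ─ ⁅ x ⁆))
                             (λ T → all? (meets? T) (HminusHBHX H B ⁅ x ⁆)))
                (cong₂ ℕ._+_ (count-btr-H₁-hitting-H₂ H B x (S ─ ⁅ x ⁆)) (count-btr-H₁-missing-H₂ H B x S x∈S))
  c+[K+a]≡a+b : c ℕ.+ (K ℕ.+ a) ≡ a ℕ.+ b
  c+[K+a]≡a+b = begin
    c ℕ.+ (K ℕ.+ a)   ≡⟨ ℕ.+-assoc c K a ⟨
    c ℕ.+ K ℕ.+ a     ≡⟨ ℕ.+-comm (c ℕ.+ K) a ⟩
    a ℕ.+ (c ℕ.+ K)   ≡⟨ cong (a ℕ.+_) b≡c+K ⟨
    a ℕ.+ b           ∎
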